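{- If $G$ is the square lattice graph of size $3\times 3$, $3\times 5$, or $4\times 4$, then $T_1(G)=3$.
   Context: The $m\times n$ square lattice graph is the Cartesian product $P_m\,\square\,P_n$ of paths on $m$ and $n$ vertices. Graphs are finite and may have loops and multiple edges; each edge $e$ with endpoints $u,v$ has half-edges $(u,e),(v,e)$. Fix a finite alphabet $\Sigma$ and disjoint copy $\hat\Sigma=\{\hat a:a\in\Sigma\}$; elements of $\Sigma\cup\hat\Sigma$ are cohesive-end types, $\hat{\hat a}=a$. A tile is a finite multiset of cohesive-end types. A pot is a finite set $P$ of tiles such that whenever $x$ occurs in a tile of $P$, $\hat x$ occurs in some tile of $P$; $\#P$ is its number of tiles. An assembly design of a graph $G$ labels half-edges by cohesive-end types so that the two half-edges of each edge receive $a$ and $\hat a$ for some $a\in\Sigma$; $\lambda(v)$ is the multiset of labels at $v$ and $P_\lambda(G)=\{\lambda(v)\}$. $P$ realizes $G$ if $P_\lambda(G)\subseteq P$ for some assembly design $\lambda$. $T_1(G)$ is the minimum of $\#P$ over all pots $P$ that realize $G$. -}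

module Defs where

open import Data.Nat using (ℕ; zero; suc; _≤_)
open import Data.Bool using (Bool; true; false; if_then_else_)
open import Data.Fin using (Fin; zero; suc; inject₁)
open import Data.List using (List; []; _∷_; _++_; [_]; map; concatMap; length; allFin)
open import Data.List.Membership.Propositional using (_∈_)
open import Data.List.Relation.Unary.Any using (Any)
open import Data.List.Relation.Unary.AllPairs using (AllPairs)
open import Data.List.Relation.Binary.Permutation.Propositional using (_↭_)
open import Data.Product using (Σ; ∃; ∃-syntax; _×_; _,_)
open import Data.Product.Properties using (≡-dec)
open import Data.Sum using (_⊎_)
open import Data.Fin.Properties renaming (_≟_ to _≟F_)
open import Relation.Binary.Definitions using (DecidableEquality)
open import Relation.Binary.PropositionalEquality using (_≡_)
open import Relation.Nullary using (¬_; does)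

-- Finite graphs (loops and multiple edges allowed).
-- An edge is an ordered pair of endpoints (u , w); its two half-edges
-- are (edge , false) at u and (edge , true) at w.

record Graph : Set₁ where
  field
    V     : Set
    _≟V_  : DecidableEquality V
    edges : List (V × V)

open Graph public

Edge : Graph → Set
Edge G = Fin (length (edges G))

-- Cohesive-end types over the alphabet Σ = ℕ (every pot / design uses
-- only finitely many letters, so this is "any finite alphabet").

data CE : Set where
  plain : ℕ → CE
  hatted : ℕ → CE

hat : CE → CE
hat (plain a) = hatted a
hat (hatted a) = plain a

-- A tile is a finite multiset of cohesive-end types: a list, considered
-- up to permutation (_↭_).
Tile : Set
Tile = List CE

record Pot : Set where
  field
    tiles    : List Tile
    distinct : AllPairs (λ s t → ¬ (s ↭ t)) tiles
    closed   : ∀ t x → t ∈ tiles → x ∈ t → ∃[ t' ] (t' ∈ tiles × hat x ∈ t')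

open Pot public

#_ : Pot → ℕ
# P = length (tiles P)

HalfLabel : Graph → Set
HalfLabel G = Edge G → Bool → CE

IsDesign : (G : Graph) → HalfLabel G → Set
IsDesign G λ' = ∀ e → ∃[ a ]
  ((λ' e false ≡ plain a × λ' e true ≡ hatted a) ⊎
   (λ' e false ≡ hatted a × λ' e true ≡ plain a))

labelsAt : {V : Set} → DecidableEquality V → (es : List (V × V)) →
           (Fin (length es) → Bool → CE) → V → List CE
labelsAt _≟_ [] d v = []
labelsAt _≟_ ((u , w) ∷ es) d v =
  (if does (u ≟ v) then [ d zero false ] else []) ++
  (if does (w ≟ v) then [ d zero true ] else []) ++
  labelsAt _≟_ es (λ k → d (suc k)) v

vertexTile : (G : Graph) → HalfLabel G → V G → Tile
vertexTile G d v = labelsAt (_≟V_ G) (edges G) d v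

Realizes : Pot → Graph → Set
Realizes P G = Σ (HalfLabel G) λ d → IsDesign G d ×
  (∀ v → Any (λ t → vertexTile G d v ↭ t) (tiles P))

T₁≡ : Graph → ℕ → Set
T₁≡ G k = (Σ Pot λ P → Realizes P G × # P ≡ k) ×
          (∀ P → Realizes P G → k ≤ # P)

pathEdges : (n : ℕ) → List (Fin n × Fin n)
pathEdges zero = []
pathEdges (suc n) = map (λ j → inject₁ j , suc j) (allFin n)

lattice : ℕ → ℕ → Graph
lattice m n = record
  { V = Fin m × Fin n
  ; _≟V_ = ≡-dec _≟F_ _≟F_
  ; edges =
      concatMap (λ i → map (λ { (a , b) → ((i , a) , (i , b)) }) (pathEdges n)) (allFin m) ++
      concatMap (λ { (a , b) → map (λ j → ((a , j) , (b , j))) (allFin n) }) (pathEdges m)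
  }

{-# OPTIONS --safe #-}
-- Lower bound: the tile used at a vertex has as many cohesive ends as the
-- vertex has neighbours, and these lattices have vertices of degree 2, 3
-- and 4, so any realizing pot has tiles of three different sizes.
-- Upper bound: a single bond type a suffices. Orienting every edge and
-- labelling its tail a and its head â, the vertex tiles of a suitable
-- orientation are {a,a}, {a,â,â}, {â,â,â,â} on the 3 × 3 lattice and
-- {a,a}, {a,â,â}, {a,a,â,â} on the 3 × 5 and 4 × 4 lattices.
module Submission where

open import Defs
open import Data.Bool using (Bool; true; false; if_then_else_)
open import Data.Fin using (Fin; zero; suc; toℕ)
open import Data.Fin.Properties using (pigeonhole; <⇒≢; toℕ-injective)
open import Data.List using (List; []; _∷_; _++_; length; lookup; replicate; map)
open import Data.List.Membership.Propositional using (_∈_; find)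
open import Data.List.Relation.Binary.Permutation.Propositional using (_↭_; refl; prep; swap; trans)
open import Data.List.Relation.Binary.Permutation.Propositional.Properties using (↭-length)
open import Data.List.Relation.Unary.All as All using (All; []; _∷_)
open import Data.List.Relation.Unary.All.Properties using (++⁺; replicate⁺; map⁺)
open import Data.List.Relation.Unary.AllPairs as AllPairs using (AllPairs; []; _∷_)
open import Data.List.Relation.Unary.Any as Any using (Any; here; there)
open import Data.List.Relation.Unary.Any.Properties using (lookup-index)
open import Data.Maybe as Maybe using (Maybe; just; nothing; from-just)
open import Data.Nat using (ℕ; zero; suc; _+_; _≤_; _<?_)
open import Data.Nat.Properties using (≮⇒≥; +-cancelˡ-≡) renaming (_≟_ to _≟ℕ_)
open import Data.Product using (∃-syntax; _×_; _,_)
open import Data.Sum using (_⊎_; inj₁; inj₂)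
open import Data.Vec as Vec using (Vec; []; _∷_)
open import Function using (_∘_)
open import Function.Definitions using (Injective)
open import Relation.Binary.Definitions using (DecidableEquality)
open import Relation.Binary.PropositionalEquality using (_≡_; _≢_; refl; cong; sym) renaming (trans to ≡-trans)
open import Relation.Nullary using (¬_; yes; no; does; contradiction)

_≟CE_ : DecidableEquality CE
plain m ≟CE plain n with m ≟ℕ n
... | yes refl = yes refl
... | no m≢n = no λ { refl → m≢n refl }
hatted m ≟CE hatted n with m ≟ℕ n
... | yes refl = yes refl
... | no m≢n = no λ { refl → m≢n refl }
plain _ ≟CE hatted _ = no λ ()
hatted _ ≟CE plain _ = no λ ()

length-labelsAt : ∀ {A : Set} (_≟_ : DecidableEquality A) (es : List (A × A))
  (d d′ : Fin (length es) → Bool → CE) (v : A) →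
  length (labelsAt _≟_ es d v) ≡ length (labelsAt _≟_ es d′ v)
length-labelsAt _≟_ [] d d′ v = refl
length-labelsAt _≟_ ((u , w) ∷ es) d d′ v with does (u ≟ v) | does (w ≟ v)
... | true  | true  = cong (2 +_) (length-labelsAt _≟_ es (d ∘ suc) (d′ ∘ suc) v)
... | true  | false = cong (1 +_) (length-labelsAt _≟_ es (d ∘ suc) (d′ ∘ suc) v)
... | false | true  = cong (1 +_) (length-labelsAt _≟_ es (d ∘ suc) (d′ ∘ suc) v)
... | false | false = length-labelsAt _≟_ es (d ∘ suc) (d′ ∘ suc) v

degree : (G : Graph) → V G → ℕ
degree G v = length (vertexTile G (λ _ _ → plain 0) v)

degree≡length-vertexTile : ∀ G (d : HalfLabel G) v → degree G v ≡ length (vertexTile G d v)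
degree≡length-vertexTile G d v = length-labelsAt (_≟V_ G) (edges G) _ d v

degree≡length-matchedTile : ∀ G (d : HalfLabel G) v (ts : List Tile)
  (match : Any (vertexTile G d v ↭_) ts) → degree G v ≡ length (lookup ts (Any.index match))
degree≡length-matchedTile G d v ts match =
  ≡-trans (degree≡length-vertexTile G d v) (↭-length (lookup-index match))

-- Pigeonhole: fewer tiles than degrees would force two vertices of
-- different degree onto the same tile.
distinctDegrees≤#pot : ∀ {k} (G : Graph) (vs : Fin k → V G) →
  Injective _≡_ _≡_ (degree G ∘ vs) → ∀ P → Realizes P G → k ≤ # P
distinctDegrees≤#pot {k} G vs degree-injective P (d , _ , realized) with # P <? k
... | no #P≮k = ≮⇒≥ #P≮k
... | yes #P<k =
  let i , j , i<j , sameTile = pigeonhole #P<k (λ i → Any.index (realized (vs i)))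
      sameDegree = ≡-trans (degree≡length-matchedTile G d (vs i) (tiles P) (realized (vs i)))
                   (≡-trans (cong (length ∘ lookup (tiles P)) sameTile)
                   (sym (degree≡length-matchedTile G d (vs j) (tiles P) (realized (vs j)))))
  in contradiction (degree-injective sameDegree) (<⇒≢ i<j)

shifted-toℕ-injective : ∀ {k} c (f : Fin k → ℕ) → (∀ i → f i ≡ c + toℕ i) → Injective _≡_ _≡_ f
shifted-toℕ-injective c f f≡c+i {i} {j} fi≡fj =
  toℕ-injective (+-cancelˡ-≡ c _ _ (≡-trans (sym (f≡c+i i)) (≡-trans fi≡fj (f≡c+i j))))

cornerSideInterior : ∀ {m n} → Fin 3 → Fin (suc (suc m)) × Fin (suc (suc n))
cornerSideInterior zero = zero , zero
cornerSideInterior (suc zero) = zero , suc zero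
cornerSideInterior (suc (suc zero)) = suc zero , suc zero

lattice-3≤#pot : ∀ {m n} →
  (∀ i → degree (lattice (suc (suc m)) (suc (suc n))) (cornerSideInterior i) ≡ 2 + toℕ i) →
  ∀ P → Realizes P (lattice (suc (suc m)) (suc (suc n))) → 3 ≤ # P
lattice-3≤#pot {m} {n} degrees =
  distinctDegrees≤#pot (lattice (suc (suc m)) (suc (suc n))) cornerSideInterior
    (shifted-toℕ-injective 2 _ degrees)

a â : CE
a = plain 0
â = hatted 0

tile : ℕ → ℕ → Tile
tile p q = replicate p a ++ replicate q â

IsSingleBond : CE → Set
IsSingleBond x = x ≡ a ⊎ x ≡ â

tile-isSingleBond : ∀ p q → All IsSingleBond (tile p q)
tile-isSingleBond p q = ++⁺ (replicate⁺ p (inj₁ refl)) (replicate⁺ q (inj₂ refl))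

lengths-distinct⇒↭-distinct : ∀ {ts : List Tile} →
  AllPairs (λ s t → length s ≢ length t) ts → AllPairs (λ s t → ¬ (s ↭ t)) ts
lengths-distinct⇒↭-distinct = AllPairs.map (λ length≢ s↭t → length≢ (↭-length s↭t))

singleBondPot : (shapes : List (ℕ × ℕ)) →
  let ts = map (λ (p , q) → tile p q) shapes in
  AllPairs (λ s t → length s ≢ length t) ts → Any (a ∈_) ts → Any (â ∈_) ts → Pot
singleBondPot shapes lengths-distinct a-occurs â-occurs = record
  { tiles = ts
  ; distinct = lengths-distinct⇒↭-distinct lengths-distinct
  ; closed = complementsOccur
  }
  where
  ts = map (λ (p , q) → tile p q) shapes

  singleBond : All (All IsSingleBond) ts
  singleBond = map⁺ (All.universal (λ (p , q) → tile-isSingleBond p q) shapes)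

  complementsOccur : ∀ t x → t ∈ ts → x ∈ t → ∃[ t′ ] (t′ ∈ ts × hat x ∈ t′)
  complementsOccur t x t∈ts x∈t with All.lookup (All.lookup singleBond t∈ts) x∈t
  ... | inj₁ refl = find â-occurs
  ... | inj₂ refl = find a-occurs

orientedDesign : (G : Graph) → (Edge G → Bool) → HalfLabel G
orientedDesign G tailIsA e false = if tailIsA e then a else â
orientedDesign G tailIsA e true  = if tailIsA e then â else a

orientedDesign-isDesign : ∀ G tailIsA → IsDesign G (orientedDesign G tailIsA)
orientedDesign-isDesign G tailIsA e with tailIsA e
... | true  = 0 , inj₁ (refl , refl)
... | false = 0 , inj₂ (refl , refl)

-- Sound but incomplete proof searches: below, from-just typechecks only
-- because the searches succeed by evaluation.

module _ {A : Set} (_≟_ : DecidableEquality A) where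

  extract : (x : A) (ys : List A) → Maybe (∃[ rest ] (x ∷ rest ↭ ys))
  extract x [] = nothing
  extract x (y ∷ ys) with x ≟ y
  ... | yes refl = just (ys , refl)
  ... | no _ with extract x ys
  ...   | nothing = nothing
  ...   | just (rest , x∷rest↭ys) = just (y ∷ rest , trans (swap x y refl) (prep y x∷rest↭ys))

  search-↭ : (xs ys : List A) → Maybe (xs ↭ ys)
  search-↭ [] [] = just refl
  search-↭ [] (_ ∷ _) = nothing
  search-↭ (x ∷ xs) ys with extract x ys
  ... | nothing = nothing
  ... | just (rest , x∷rest↭ys) with search-↭ xs rest
  ...   | nothing = nothing
  ...   | just xs↭rest = just (trans (prep x xs↭rest) x∷rest↭ys)

search-Any : ∀ {A : Set} {P : A → Set} → (∀ x → Maybe (P x)) → ∀ xs → Maybe (Any P xs)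
search-Any P? [] = nothing
search-Any P? (x ∷ xs) with P? x
... | just px = just (here px)
... | nothing with search-Any P? xs
...   | just pxs = just (there pxs)
...   | nothing = nothing

search-∀Fin : ∀ {n} {P : Fin n → Set} → (∀ i → Maybe (P i)) → Maybe (∀ i → P i)
search-∀Fin {zero} P? = just λ ()
search-∀Fin {suc n} P? with P? zero | search-∀Fin (P? ∘ suc)
... | just p₀ | just p₊ = just λ { zero → p₀ ; (suc i) → p₊ i }
... | _ | _ = nothing

search-latticeRealization : ∀ P m n → Vec Bool (length (edges (lattice m n))) →
  Maybe (Realizes P (lattice m n))
search-latticeRealization P m n orientation =
  Maybe.map (λ tileAt → design , orientedDesign-isDesign G tailIsA , λ (i , j) → tileAt i j)
    (search-∀Fin λ i → search-∀Fin λ j →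
       search-Any (search-↭ _≟CE_ (vertexTile G design (i , j))) (tiles P))
  where
  G = lattice m n
  tailIsA = Vec.lookup orientation
  design = orientedDesign G tailIsA

pot₃ₓ₃ potₘₓₙ : Pot
pot₃ₓ₃ = singleBondPot ((2 , 0) ∷ (1 , 2) ∷ (0 , 4) ∷ [])
  (((λ ()) ∷ (λ ()) ∷ []) ∷ ((λ ()) ∷ []) ∷ [] ∷ [])
  (there (here (here refl))) (there (here (there (here refl))))
potₘₓₙ = singleBondPot ((2 , 0) ∷ (1 , 2) ∷ (2 , 2) ∷ [])
  (((λ ()) ∷ (λ ()) ∷ []) ∷ ((λ ()) ∷ []) ∷ [] ∷ [])
  (there (here (here refl))) (there (here (there (here refl))))

T₁≡-intro : ∀ G (P : Pot) → Realizes P G → (∀ Q → Realizes Q G → # P ≤ # Q) → T₁≡ G (# P)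
T₁≡-intro G P realizes minimal = (P , realizes , refl) , minimal

-- Indexed by the edges of lattice m n in list order: the edges inside each
-- row, row by row, then those between consecutive rows; true labels the
-- first endpoint of the edge a.
orientation₃ₓ₃ : Vec Bool 12
orientation₃ₓ₃ = true ∷ false ∷ true ∷ false ∷ true ∷ false ∷ true ∷ true ∷ true ∷ false ∷ false ∷ false ∷ []

orientation₃ₓ₅ : Vec Bool 22
orientation₃ₓ₅ =
  true ∷ true ∷ true ∷ false ∷ true ∷ true ∷ false ∷ false ∷ true ∷ false ∷ false ∷
  false ∷ true ∷ false ∷ false ∷ true ∷ true ∷ false ∷ false ∷ true ∷ true ∷ false ∷ []

orientation₄ₓ₄ : Vec Bool 24
orientation₄ₓ₄ =
  true ∷ true ∷ false ∷ true ∷ true ∷ true ∷ false ∷ false ∷ false ∷ true ∷ false ∷ false ∷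
  true ∷ false ∷ true ∷ true ∷ false ∷ false ∷ true ∷ true ∷ false ∷ false ∷ true ∷ false ∷ []

proposition6 : T₁≡ (lattice 3 3) 3 × T₁≡ (lattice 3 5) 3 × T₁≡ (lattice 4 4) 3
proposition6 =
    T₁≡-intro (lattice 3 3) pot₃ₓ₃
      (from-just (search-latticeRealization pot₃ₓ₃ 3 3 orientation₃ₓ₃))
      (lattice-3≤#pot λ { zero → refl ; (suc zero) → refl ; (suc (suc zero)) → refl })
  , T₁≡-intro (lattice 3 5) potₘₓₙ
      (from-just (search-latticeRealization potₘₓₙ 3 5 orientation₃ₓ₅))
      (lattice-3≤#pot λ { zero → refl ; (suc zero) → refl ; (suc (suc zero)) → refl })
  , T₁≡-intro (lattice 4 4) potₘₓₙ
      (from-just (search-latticeRealization potₘₓₙ 4 4 orientation₄ₓ₄))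
      (lattice-3≤#pot λ { zero → refl ; (suc zero) → refl ; (suc (suc zero)) → refl })
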